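{- Let $D$ be a delta-matroid on $[n,\overline n]$. If $n=0$, then $U_D(u,v)=1$. For any $i\in[n]$, $$U_D(u,v)=\begin{cases}U_{D/i}(u,v)+U_{D\setminus i}(u,v)+u\,U_{D(i)}(u,v), & i\text{ is neither a loop nor a coloop},\\ (u+v+1)\,U_{D\setminus i}(u,v), & i\text{ is a loop or a coloop}.\end{cases}$$
   Context: Let $[n,\overline{n}]=\{1,\dots,n,\overline{1},\dots,\overline{n}\}$ with involution $a\mapsto\overline a$; $\overline S=\{\overline a:a\in S\}$. For $E\subseteq[n]$, a subset of $E\cup\overline E$ is admissible if it contains at most one of $i,\overline i$ for each $i$. A delta-matroid on $E\cup\overline E$ is a non-empty collection $\mathcal F$ of admissible subsets of size $|E|$ (feasible sets) such that $\operatorname{Conv}\{e_B:B\in\mathcal F\}\subseteq\mathbb{R}^E$ has all edges parallel to some $e_i$ or $e_i\pm e_j$ ($e_{\overline i}=-e_i$, $e_S=\sum_{a\in S}e_a$). Rank function $g_D(S)=\max_{B\in\mathcal F}(|S\cap B|-|\overline S\cap B|)$; $U$-polynomial $U_D(u,v)=\sum_{S}u^{|E|-|S|}v^{(|S|-g_D(S))/2}$, the sum over admissible $S\subseteq E\cup\overline E$. For $i\in E$: $i$ is a loop if no feasible set contains $i$, a coloop if every feasible set contains $i$. If $i$ is not a loop, $D/i$ has feasible sets $B\setminus\{i\}$ for feasible $B\ni i$; if $i$ is not a coloop, $D\setminus i$ has feasible sets $B\setminus\{\overline i\}$ for feasible $B\ni\overline i$; $D(i)$ has feasible sets $B\setminus\{i,\overline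 i\}$, $B\in\mathcal F$; if $i$ is a loop or coloop, $D/i=D\setminus i=D(i)$. These are delta-matroids on $(E\setminus\{i\})\cup\overline{(E\setminus\{i\})}$. -}

module Defs where

open import Level using (Level)
open import Data.Nat using (ℕ; zero; suc; _≤_) renaming (_+_ to _+ℕ_)
open import Data.Nat using (⌊_/2⌋)
open import Data.Bool using (Bool; true; false; _∧_; _∨_; if_then_else_; not)
open import Data.Bool.Properties using () renaming (_≟_ to _≟B_)
open import Data.Maybe using (Maybe; just; nothing)
open import Data.Fin using (Fin)
open import Data.Vec using (Vec; []; _∷_; lookup; insertAt)
open import Data.List using (List; []; _∷_; map; concatMap; foldr; filter)
open import Data.Bool.ListAction using (any)
open import Data.Integer as ℤ using (ℤ; +_; -[1+_]; ∣_∣) renaming (_+_ to _+ℤ_; _-_ to _-ℤ_; _*_ to _*ℤ_; _⊔_ to _⊔ℤ_)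
open import Data.Product using (Σ; ∃; _×_; _,_)
open import Data.Sum using (_⊎_)
open import Relation.Binary.PropositionalEquality using (_≡_; _≢_)
open import Algebra.Bundles using (CommutativeSemiring)

-- Ground set E = [n] is  Fin n.
-- * A feasible set B (admissible, of size |E|) contains exactly one of
--   i, ī for every i; it is encoded as  B : Vec Bool n  with
--   lookup B i = true  iff  i ∈ B  (and = false iff ī ∈ B).
-- * An admissible set S ⊆ E ∪ Ē is encoded as  S : Vec (Maybe Bool) n
--   with  just true = "i ∈ S",  just false = "ī ∈ S",  nothing = neither.
-- * A set system is its (decidable) membership function
--   Vec Bool n → Bool.

SetSystem : ℕ → Set
SetSystem n = Vec Bool n → Bool

allBool : (n : ℕ) → List (Vec Bool n)
allBool zero    = [] ∷ []
allBool (suc n) = concatMap (λ xs → (true ∷ xs) ∷ (false ∷ xs) ∷ []) (allBool n)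

allAdm : (n : ℕ) → List (Vec (Maybe Bool) n)
allAdm zero    = [] ∷ []
allAdm (suc n) = concatMap (λ xs → (just true ∷ xs) ∷ (just false ∷ xs) ∷ (nothing ∷ xs) ∷ []) (allAdm n)

-- the point e_B ∈ ℝ^E paired with an (integer) linear functional w
sgn : Bool → ℤ
sgn true  = + 1
sgn false = -[1+ 0 ]

dot : ∀ {n} → Vec ℤ n → Vec Bool n → ℤ
dot []       []       = + 0
dot (w ∷ ws) (b ∷ bs) = w *ℤ sgn b +ℤ dot ws bs

-- number of coordinates in which two feasible sets differ
-- (e_B - e_B' = 2 * Σ_{k differs} ± e_k)
diffCount : ∀ {n} → Vec Bool n → Vec Bool n → ℕ
diffCount []       []       = 0
diffCount (a ∷ as) (b ∷ bs) = (if (a ≟B b) .Relation.Nullary.Decidable.Core.does then 0 else 1) +ℕ diffCount as bs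
  where open import Relation.Nullary.Decidable.Core using (does)

-- [e_B, e_B'] is an edge of Conv{e_C : C ∈ F}: B ≠ B' and the face of the
-- polytope maximizing some linear functional w is exactly that segment.
-- (All points e_C are vertices of the cube, hence of the polytope, so the
-- face cut out by w is an edge iff the feasible points on which w is
-- maximal are exactly B and B'.  Rational functionals suffice for a
-- rational polytope and can be scaled to integer ones.)
IsEdge : ∀ {n} → SetSystem n → Vec Bool n → Vec Bool n → Set
IsEdge {n} F B B' =
  F B ≡ true × F B' ≡ true × B ≢ B' ×
  Σ (Vec ℤ n) λ w →
    dot w B ≡ dot w B' ×
    (∀ C → F C ≡ true → (dot w C ℤ.≤ dot w B) × (dot w C ≡ dot w B → (C ≡ B) ⊎ (C ≡ B')))

-- Delta-matroid (polytope definition): non-empty, and every edge direction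
-- e_B - e_B' is parallel to some e_i or e_i ± e_j, i.e. B, B' differ in
-- at most two coordinates.
record DeltaMatroid (n : ℕ) : Set where
  field
    feasible : SetSystem n
    nonempty : ∃ λ B → feasible B ≡ true
    edgeDirections : ∀ B B' → IsEdge feasible B B' → diffCount B B' ≤ 2
open DeltaMatroid public

-- |S ∩ B| - |S̄ ∩ B|
pairVal : ∀ {n} → Vec (Maybe Bool) n → Vec Bool n → ℤ
pairVal []              []       = + 0
pairVal (nothing ∷ ss)  (b ∷ bs) = pairVal ss bs
pairVal (just s ∷ ss)   (b ∷ bs) = (if (s ≟B b) .does then + 1 else -[1+ 0 ]) +ℤ pairVal ss bs
  where open import Relation.Nullary.Decidable.Core using (does)

feasibleList : ∀ {n} → SetSystem n → List (Vec Bool n)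
feasibleList {n} F = filter (λ B → F B ≟B true) (allBool n)

-- g_F(S) = max over feasible B of pairVal S B.  The fold starts at
-- -(n+1), strictly below every value pairVal S B ≥ -n, so for a non-empty
-- family this is exactly the maximum.
rank : ∀ {n} → SetSystem n → Vec (Maybe Bool) n → ℤ
rank {n} F S = foldr _⊔ℤ_ -[1+ n ] (map (pairVal S) (feasibleList F))

size : ∀ {n} → Vec (Maybe Bool) n → ℕ
size []             = 0
size (nothing ∷ ss) = size ss
size (just _ ∷ ss)  = suc (size ss)

-- (|S| - g(S)) / 2   (a non-negative even integer for non-empty F)
vExp : ∀ {n} → SetSystem n → Vec (Maybe Bool) n → ℕ
vExp F S = ⌊ ∣ + size S -ℤ rank F S ∣ /2⌋

module _ {c ℓ : Level} (R : CommutativeSemiring c ℓ) where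
  open CommutativeSemiring R

  pow : Carrier → ℕ → Carrier
  pow x zero    = 1#
  pow x (suc k) = x * pow x k

  Upoly : ∀ {n} → SetSystem n → Carrier → Carrier → Carrier
  Upoly {n} F u v =
    foldr _+_ 0# (map (λ S → pow u (n Data.Nat.∸ size S) * pow v (vExp F S)) (allAdm n))

-- Loops, coloops, minors.  Element i ∈ Fin (suc n); feasible sets of the
-- minor are vectors of length n (coordinate i removed).

IsLoop : ∀ {n} → SetSystem (suc n) → Fin (suc n) → Set
IsLoop F i = ∀ B → F B ≡ true → lookup B i ≡ false

IsColoop : ∀ {n} → SetSystem (suc n) → Fin (suc n) → Set
IsColoop F i = ∀ B → F B ≡ true → lookup B i ≡ true

hasSign : ∀ {n} → SetSystem (suc n) → Fin (suc n) → Bool → Bool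
hasSign {n} F i b = any (λ B → F B ∧ (if (lookup B i ≟B b) .does then true else false)) (allBool (suc n))
  where open import Relation.Nullary.Decidable.Core using (does)

-- D(i): feasible sets B \ {i, ī}
projMinor : ∀ {n} → SetSystem (suc n) → Fin (suc n) → SetSystem n
projMinor F i B = F (insertAt B i true) ∨ F (insertAt B i false)

-- D/i: feasible sets B \ {i} for feasible B ∋ i, if i is not a loop;
-- D(i) if i is a loop (then D/i = D\i = D(i)).  (If i is a coloop, the
-- first branch already coincides with D(i).)
contraction : ∀ {n} → SetSystem (suc n) → Fin (suc n) → SetSystem n
contraction F i =
  if hasSign F i true
  then (λ B → F (insertAt B i true)) else projMinor F i

-- D\i: feasible sets B \ {ī} for feasible B ∋ ī, if i is not a coloop;
-- D(i) if i is a coloop.  (If i is a loop, the first branch already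
-- coincides with D(i).)
deletion : ∀ {n} → SetSystem (suc n) → Fin (suc n) → SetSystem n
deletion F i =
  if hasSign F i false
  then (λ B → F (insertAt B i false)) else projMinor F i

{-# OPTIONS --safe #-}
-- Sorting each admissible set by whether it contains i, ī or neither writes U_D as a sum, over the admissible sets S
-- of E∖i, of three terms. Sets avoiding i and ī have g_D(S) = g_{D(i)}(S), which gives u·U_{D(i)}. If i is a loop or
-- a coloop, adding the sign of i carried by every feasible set raises g by 1 and adding the other sign lowers it by 1,
-- so the three terms are U, vU and uU with U = U_{D∖i}. Otherwise g_D(S ∪ i) = 1 + g_{D/i}(S) and
-- g_D(S ∪ ī) = 1 + g_{D∖i}(S): the competitor −1 + g coming from the other fibre never wins, because g_{D/i} and
-- g_{D∖i} differ by at most 2. This is where the delta-matroid axiom enters: maximisers over the two fibres of a generic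
-- perturbation of B ↦ |S ∩ B| − |S̄ ∩ B| span an edge of the feasible polytope, so they differ only in i and at most
-- one further element.
module Submission where

open import Defs
open import Level using (Level)
open import Data.Bool using (Bool; true; false; not; if_then_else_; T)
open import Data.Bool.Properties using (T-≡; T-∧; ∨-zeroʳ; ∨-identityʳ; ¬-not; not-¬) renaming (_≟_ to _≟B_)
open import Data.Fin using (Fin) renaming (zero to fzero; suc to fsuc)
open import Data.Integer as ℤ using (ℤ; +_; -[1+_]; 0ℤ; +≤+; -≤+; -<+; -<-)
  renaming (_+_ to _+ℤ_; _-_ to _-ℤ_; _*_ to _*ℤ_; -_ to -ℤ_; _≤_ to _≤ℤ_; _<_ to _<ℤ_)
import Data.Integer.Properties as ℤP
open import Data.Integer.Tactic.RingSolver using (solve-∀)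
open import Data.List using (List; []; _∷_; map; foldr; concatMap; _++_)
open import Data.List.Membership.Propositional using (_∈_)
open import Data.List.Membership.Propositional.Properties
  using (∈-concatMap⁺; ∈-filter⁺; ∈-filter⁻; ∈-map⁺; ∈-map⁻; foldr-selective)
open import Data.List.Properties using (filter-≐; foldr-forcesᵇ; map-cong)
import Data.List.Relation.Unary.All as All
open import Data.List.Relation.Unary.Any as Any using (here; there; satisfied)
open import Data.List.Relation.Unary.Any.Properties using (any⁺; any⁻)
open import Data.Maybe using (Maybe; just; nothing)
open import Data.Nat as ℕ using (ℕ; zero; suc; z≤n; s≤s; _∸_; ⌊_/2⌋)
open import Data.Nat.Divisibility using (∣⇒≤; m∣m*n) renaming (_∣_ to _ℕ∣_)
import Data.Nat.Properties as ℕP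
open import Data.Product using (∃; ∃-syntax; _×_; _,_; proj₁; proj₂)
open import Data.Sum using (_⊎_; inj₁; inj₂; [_,_]′)
open import Data.Vec using (Vec; []; _∷_; lookup; insertAt; removeAt; replicate; zipWith)
  renaming (map to vmap)
open import Data.Vec.Properties using (insertAt-lookup; insertAt-removeAt)
open import Data.Empty using (⊥-elim)
open import Function using (_∘_; Equivalence)
open import Relation.Nullary using (¬_; does; yes; no)
open import Relation.Binary.PropositionalEquality
  using (_≡_; _≢_; refl; sym; trans; cong; cong₂; subst; subst₂)
open import Algebra.Bundles using (CommutativeSemiring; AbelianGroup)
open import Algebra.Properties.CommutativeSemigroup ℤP.+-commutativeSemigroup
  using () renaming (x∙yz≈y∙xz to +ℤ-leftComm)
open import Algebra.Properties.CommutativeSemigroup ℕP.+-commutativeSemigroup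
  using () renaming (x∙yz≈y∙xz to +ℕ-leftComm)
open import Data.List.Extrema ℤP.≤-totalOrder using (argmax; argmax-all; f[xs]≤f[argmax])
open import Algebra.Properties.Group (AbelianGroup.group ℤP.+-0-abelianGroup)
  using () renaming (∙-cancelˡ to +ℤ-cancelˡ; ∙-cancelʳ to +ℤ-cancelʳ)

data InsertAtView {A : Set} {n : ℕ} (i : Fin (suc n)) : Vec A (suc n) → Set where
  insertAt-view : (xs : Vec A n) (x : A) → InsertAtView i (insertAt xs i x)

insertAtView : ∀ {A : Set} {n} (i : Fin (suc n)) (xs : Vec A (suc n)) → InsertAtView i xs
insertAtView i xs = subst (InsertAtView i) (insertAt-removeAt xs i) (insertAt-view (removeAt xs i) (lookup xs i))

agreement : Bool → Bool → ℤ
agreement s b = if (s ≟B b) .does then + 1 else -[1+ 0 ]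

contribution : Maybe Bool → Bool → ℤ
contribution nothing  _ = 0ℤ
contribution (just s) b = agreement s b

agreement-refl : ∀ b → agreement b b ≡ + 1
agreement-refl true  = refl
agreement-refl false = refl

agreement-not : ∀ b → agreement (not b) b ≡ -[1+ 0 ]
agreement-not true  = refl
agreement-not false = refl

agreement≤1 : ∀ s b → agreement s b ≤ℤ + 1
agreement≤1 true  true  = ℤP.≤-refl
agreement≤1 true  false = -≤+
agreement≤1 false true  = -≤+
agreement≤1 false false = ℤP.≤-refl

-1≤agreement : ∀ s b → -[1+ 0 ] ≤ℤ agreement s b
-1≤agreement true  true  = -≤+
-1≤agreement true  false = ℤP.≤-refl
-1≤agreement false true  = ℤP.≤-refl
-1≤agreement false false = -≤+

pairVal-insertAt : ∀ {n} (S : Vec (Maybe Bool) n) (i : Fin (suc n)) a (B : Vec Bool n) c →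
  pairVal (insertAt S i a) (insertAt B i c) ≡ contribution a c +ℤ pairVal S B
pairVal-insertAt S            fzero    nothing  B       c = sym (ℤP.+-identityˡ _)
pairVal-insertAt S            fzero    (just s) B       c = refl
pairVal-insertAt (nothing ∷ S) (fsuc i) a        (b ∷ B) c = pairVal-insertAt S i a B c
pairVal-insertAt (just s ∷ S)  (fsuc i) a        (b ∷ B) c = begin-equality
  agreement s b +ℤ pairVal (insertAt S i a) (insertAt B i c)
    ≡⟨ cong (agreement s b +ℤ_) (pairVal-insertAt S i a B c) ⟩
  agreement s b +ℤ (contribution a c +ℤ pairVal S B)
    ≡⟨ +ℤ-leftComm (agreement s b) (contribution a c) (pairVal S B) ⟩
  contribution a c +ℤ (agreement s b +ℤ pairVal S B) ∎
  where open ℤP.≤-Reasoning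

size-insertAt-just : ∀ {n} (S : Vec (Maybe Bool) n) i s → size (insertAt S i (just s)) ≡ suc (size S)
size-insertAt-just S             fzero    s = refl
size-insertAt-just (nothing ∷ S) (fsuc i) s = size-insertAt-just S i s
size-insertAt-just (just _ ∷ S)  (fsuc i) s = cong suc (size-insertAt-just S i s)

size-insertAt-nothing : ∀ {n} (S : Vec (Maybe Bool) n) i → size (insertAt S i nothing) ≡ size S
size-insertAt-nothing S             fzero    = refl
size-insertAt-nothing (nothing ∷ S) (fsuc i) = size-insertAt-nothing S i
size-insertAt-nothing (just _ ∷ S)  (fsuc i) = cong suc (size-insertAt-nothing S i)

size≤length : ∀ {n} (S : Vec (Maybe Bool) n) → size S ℕ.≤ n
size≤length []            = z≤n
size≤length (nothing ∷ S) = ℕP.m≤n⇒m≤1+n (size≤length S)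
size≤length (just _ ∷ S)  = s≤s (size≤length S)

pairVal≤size : ∀ {n} (S : Vec (Maybe Bool) n) B → pairVal S B ≤ℤ + size S
pairVal≤size []            []      = ℤP.≤-refl
pairVal≤size (nothing ∷ S) (b ∷ B) = pairVal≤size S B
pairVal≤size (just s ∷ S)  (b ∷ B) = ℤP.+-mono-≤ (agreement≤1 s b) (pairVal≤size S B)

-[1+length]<pairVal : ∀ {n} (S : Vec (Maybe Bool) n) B → -[1+ n ] <ℤ pairVal S B
-[1+length]<pairVal []            []      = -<+
-[1+length]<pairVal (nothing ∷ S) (b ∷ B) = ℤP.<-trans (-<- ℕP.≤-refl) (-[1+length]<pairVal S B)
-[1+length]<pairVal (just s ∷ S)  (b ∷ B) = ℤP.+-mono-≤-< (-1≤agreement s b) (-[1+length]<pairVal S B)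

-1+x≤1+y : ∀ x y → x ≤ℤ + 2 +ℤ y → -[1+ 0 ] +ℤ x ≤ℤ + 1 +ℤ y
-1+x≤1+y x y x≤2+y = begin
  -[1+ 0 ] +ℤ x             ≤⟨ ℤP.+-monoʳ-≤ -[1+ 0 ] x≤2+y ⟩
  -[1+ 0 ] +ℤ (+ 2 +ℤ y)    ≡⟨ sym (ℤP.+-assoc -[1+ 0 ] (+ 2) y) ⟩
  + 1 +ℤ y                  ∎
  where open ℤP.≤-Reasoning

∈-allBool : ∀ {n} (B : Vec Bool n) → B ∈ allBool n
∈-allBool []      = here refl
∈-allBool (b ∷ B) = ∈-concatMap⁺ _ (Any.map (λ { refl → head b }) (∈-allBool B))
  where
  head : ∀ b → (b ∷ B) ∈ (true ∷ B) ∷ (false ∷ B) ∷ []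
  head true  = here refl
  head false = there (here refl)

NonEmpty : ∀ {n} → SetSystem n → Set
NonEmpty F = ∃[ B ] F B ≡ true

∈-feasibleList : ∀ {n} {F : SetSystem n} {B} → F B ≡ true → B ∈ feasibleList F
∈-feasibleList {F = F} {B} FB = ∈-filter⁺ (λ B → F B ≟B true) (∈-allBool B) FB

feasibleList-sound : ∀ {n} {F : SetSystem n} {B} → B ∈ feasibleList F → F B ≡ true
feasibleList-sound {n} {F} B∈ = proj₂ (∈-filter⁻ (λ B → F B ≟B true) {xs = allBool n} B∈)

module _ {n} (F : SetSystem n) (S : Vec (Maybe Bool) n) where

  rank-upper : ∀ {B} → F B ≡ true → pairVal S B ≤ℤ rank F S
  rank-upper {B} FB = All.lookup (foldr-forcesᵇ forces -[1+ n ] _ ℤP.≤-refl)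
    (∈-map⁺ (pairVal S) (∈-feasibleList FB))
    where
    forces : ∀ x y → x ℤ.⊔ y ≤ℤ rank F S → x ≤ℤ rank F S × y ≤ℤ rank F S
    forces x y h = ℤP.≤-trans (ℤP.i≤i⊔j x y) h , ℤP.≤-trans (ℤP.i≤j⊔i x y) h

  rank-attained : NonEmpty F → ∃[ B ] F B ≡ true × pairVal S B ≡ rank F S
  rank-attained (B₀ , FB₀) with foldr-selective ℤP.⊔-sel -[1+ n ] (map (pairVal S) (feasibleList F))
  ... | inj₁ rank≡base = ⊥-elim (ℤP.<⇒≱ (-[1+length]<pairVal S B₀)
                                     (subst (pairVal S B₀ ≤ℤ_) rank≡base (rank-upper FB₀)))
  ... | inj₂ rank∈values with ∈-map⁻ (pairVal S) rank∈values
  ...   | B , B∈feasible , rank≡ = B , feasibleList-sound B∈feasible , sym rank≡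

  rank-unique : ∀ {r} → (∃[ B ] F B ≡ true × pairVal S B ≡ r) →
                (∀ B → F B ≡ true → pairVal S B ≤ℤ r) → rank F S ≡ r
  rank-unique (B , FB , refl) upper with rank-attained (B , FB)
  ... | B′ , FB′ , attained = ℤP.≤-antisym (subst (_≤ℤ _) attained (upper B′ FB′)) (rank-upper FB)

  rank≤size : NonEmpty F → rank F S ≤ℤ + size S
  rank≤size nonempty with rank-attained nonempty
  ... | B , _ , attained = subst (_≤ℤ _) attained (pairVal≤size S B)

rank-cong : ∀ {n} {F G : SetSystem n} → (∀ B → F B ≡ G B) → ∀ S → rank F S ≡ rank G S
rank-cong {n} {F} {G} F≗G S = cong (foldr ℤ._⊔_ -[1+ n ] ∘ map (pairVal S))
  (filter-≐ (λ B → F B ≟B true) (λ B → G B ≟B true)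
            ((λ {B} FB → trans (sym (F≗G B)) FB) , (λ {B} GB → trans (F≗G B) GB)) (allBool n))

rank-mono : ∀ {n} {F G : SetSystem n} → NonEmpty F → (∀ {B} → F B ≡ true → G B ≡ true) →
            ∀ S → rank F S ≤ℤ rank G S
rank-mono {F = F} {G} nonempty F⊆G S with rank-attained F S nonempty
... | B , FB , attained = subst (_≤ℤ _) attained (rank-upper G S (F⊆G FB))

fibre : ∀ {n} → SetSystem (suc n) → Fin (suc n) → Bool → SetSystem n
fibre F i c B = F (insertAt B i c)

-- IsLoop F i and IsColoop F i are IsConstantAt F i false and IsConstantAt F i true by definition.
IsConstantAt : ∀ {n} → SetSystem (suc n) → Fin (suc n) → Bool → Set
IsConstantAt F i c = ∀ B → F B ≡ true → lookup B i ≡ c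

T-agrees⇒≡ : ∀ x b → T (if (x ≟B b) .does then true else false) → x ≡ b
T-agrees⇒≡ true  true  _ = refl
T-agrees⇒≡ false false _ = refl

T-agrees : ∀ b → T (if (b ≟B b) .does then true else false)
T-agrees true  = _
T-agrees false = _

module _ {n} (F : SetSystem (suc n)) (i : Fin (suc n)) where

  hasSign-sound : ∀ {b} → hasSign F i b ≡ true → NonEmpty (fibre F i b)
  hasSign-sound {b} has with satisfied (any⁻ _ (allBool (suc n)) (Equivalence.from T-≡ has))
  ... | B , T[FB∧B[i]≡b] with insertAtView i B
  ...   | insertAt-view B′ c = B′ , subst (λ c → F (insertAt B′ i c) ≡ true) c≡b FB
    where
    FB∧B[i]≡b : T (F (insertAt B′ i c)) × T (if (lookup (insertAt B′ i c) i ≟B b) .does then true else false)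
    FB∧B[i]≡b = Equivalence.to (T-∧ {F (insertAt B′ i c)}) T[FB∧B[i]≡b]
    FB : F (insertAt B′ i c) ≡ true
    FB = Equivalence.to T-≡ (proj₁ FB∧B[i]≡b)
    c≡b : c ≡ b
    c≡b = trans (sym (insertAt-lookup B′ i c)) (T-agrees⇒≡ _ b (proj₂ FB∧B[i]≡b))

  hasSign-complete : ∀ {b} → NonEmpty (fibre F i b) → hasSign F i b ≡ true
  hasSign-complete {b} (B , FB) = Equivalence.to T-≡
    (any⁺ _ (Any.map (λ { refl → Equivalence.from T-∧ (Equivalence.from T-≡ FB , T[B[i]≡b]) })
                     (∈-allBool (insertAt B i b))))
    where
    T[B[i]≡b] : T (if (lookup (insertAt B i b) i ≟B b) .does then true else false)
    T[B[i]≡b] rewrite insertAt-lookup B i b = T-agrees b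

  fibre-nonempty : ∀ b → ¬ IsConstantAt F i (not b) → NonEmpty (fibre F i b)
  fibre-nonempty b nonConstant with hasSign F i b in has
  ... | true  = hasSign-sound has
  ... | false = ⊥-elim (nonConstant constant)
    where
    constant : IsConstantAt F i (not b)
    constant B FB with insertAtView i B
    ... | insertAt-view B′ c = trans (insertAt-lookup B′ i c) (¬-not c≢b)
      where
      c≢b : c ≢ b
      c≢b refl with trans (sym (hasSign-complete (B′ , FB))) has
      ... | ()

  contraction-nonLoop : ¬ IsLoop F i → contraction F i ≡ fibre F i true
  contraction-nonLoop nonLoop =
    cong (λ h → if h then fibre F i true else projMinor F i) (hasSign-complete (fibre-nonempty true nonLoop))

  deletion-nonColoop : ¬ IsColoop F i → deletion F i ≡ fibre F i false
  deletion-nonColoop nonColoop =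
    cong (λ h → if h then fibre F i false else projMinor F i) (hasSign-complete (fibre-nonempty false nonColoop))

  projMinor-intro : ∀ {B} c → fibre F i c B ≡ true → projMinor F i B ≡ true
  projMinor-intro {B} true  FB rewrite FB = refl
  projMinor-intro {B} false FB rewrite FB = ∨-zeroʳ _

  projMinor-elim : ∀ {B} → projMinor F i B ≡ true → ∃[ c ] fibre F i c B ≡ true
  projMinor-elim {B} FB with F (insertAt B i true) in F[B+i]
  ... | true  = true , F[B+i]
  ... | false = false , FB

  some-fibre-nonempty : NonEmpty F → ∃[ c ] NonEmpty (fibre F i c)
  some-fibre-nonempty (B , FB) with insertAtView i B
  ... | insertAt-view B′ c = c , B′ , FB

  projMinor-nonempty : NonEmpty F → NonEmpty (projMinor F i)
  projMinor-nonempty nonempty with some-fibre-nonempty nonempty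
  ... | c , B , FB = B , projMinor-intro c FB

  rank-insertAt : ∀ S a {r} →
    (∃[ c ] NonEmpty (fibre F i c) × contribution a c +ℤ rank (fibre F i c) S ≡ r) →
    (∀ c → NonEmpty (fibre F i c) → contribution a c +ℤ rank (fibre F i c) S ≤ℤ r) →
    rank F (insertAt S i a) ≡ r
  rank-insertAt S a {r} (c , nonempty , attained) upper = rank-unique F (insertAt S i a) maximiser bounded
    where
    open ℤP.≤-Reasoning
    maximiser : ∃[ B ] F B ≡ true × pairVal (insertAt S i a) B ≡ r
    maximiser with rank-attained (fibre F i c) S nonempty
    ... | B , FB , fibre-attained = insertAt B i c , FB , (begin-equality
      pairVal (insertAt S i a) (insertAt B i c)    ≡⟨ pairVal-insertAt S i a B c ⟩
      contribution a c +ℤ pairVal S B              ≡⟨ cong (contribution a c +ℤ_) fibre-attained ⟩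
      contribution a c +ℤ rank (fibre F i c) S     ≡⟨ attained ⟩
      r                                            ∎)
    bounded : ∀ B → F B ≡ true → pairVal (insertAt S i a) B ≤ℤ r
    bounded B FB with insertAtView i B
    ... | insertAt-view B′ c′ = begin
      pairVal (insertAt S i a) (insertAt B′ i c′)    ≡⟨ pairVal-insertAt S i a B′ c′ ⟩
      contribution a c′ +ℤ pairVal S B′              ≤⟨ ℤP.+-monoʳ-≤ (contribution a c′) (rank-upper (fibre F i c′) S FB) ⟩
      contribution a c′ +ℤ rank (fibre F i c′) S     ≤⟨ upper c′ (B′ , FB) ⟩
      r                                              ∎

  rank-insertAt-nothing : NonEmpty F → ∀ S → rank F (insertAt S i nothing) ≡ rank (projMinor F i) S
  rank-insertAt-nothing nonempty S with rank-attained (projMinor F i) S (projMinor-nonempty nonempty)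
  ... | B₀ , PB₀ , proj-attained with projMinor-elim PB₀
  ...   | c₀ , FB₀ = rank-insertAt S nothing (c₀ , (B₀ , FB₀) , attained) upper
    where
    open ℤP.≤-Reasoning
    upper : ∀ c → NonEmpty (fibre F i c) → 0ℤ +ℤ rank (fibre F i c) S ≤ℤ rank (projMinor F i) S
    upper c nonempty′ = subst (_≤ℤ _) (sym (ℤP.+-identityˡ _)) (rank-mono nonempty′ (projMinor-intro c) S)
    attained : 0ℤ +ℤ rank (fibre F i c₀) S ≡ rank (projMinor F i) S
    attained = ℤP.≤-antisym (upper c₀ (B₀ , FB₀)) (begin
      rank (projMinor F i) S       ≡⟨ sym proj-attained ⟩
      pairVal S B₀                 ≤⟨ rank-upper (fibre F i c₀) S FB₀ ⟩
      rank (fibre F i c₀) S        ≡⟨ sym (ℤP.+-identityˡ _) ⟩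
      0ℤ +ℤ rank (fibre F i c₀) S  ∎)

  constant-fibre-nonempty : ∀ {c} → IsConstantAt F i c → NonEmpty F → NonEmpty (fibre F i c)
  constant-fibre-nonempty constant nonempty with some-fibre-nonempty nonempty
  ... | c′ , B , FB with trans (sym (insertAt-lookup B i c′)) (constant _ FB)
  ...   | refl = B , FB

  rank-insertAt-constant : ∀ {c} → IsConstantAt F i c → NonEmpty F →
    ∀ S a → rank F (insertAt S i a) ≡ contribution a c +ℤ rank (fibre F i c) S
  rank-insertAt-constant {c} constant nonempty S a =
    rank-insertAt S a (c , constant-fibre-nonempty constant nonempty , refl) upper
    where
    upper : ∀ c″ → NonEmpty (fibre F i c″) →
            contribution a c″ +ℤ rank (fibre F i c″) S ≤ℤ contribution a c +ℤ rank (fibre F i c) S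
    upper c″ (B″ , FB″) with trans (sym (insertAt-lookup B″ i c″)) (constant _ FB″)
    ... | refl = ℤP.≤-refl

  rank-insertAt-exchange : NonEmpty (fibre F i true) → NonEmpty (fibre F i false) →
    (∀ S c → rank (fibre F i (not c)) S ≤ℤ + 2 +ℤ rank (fibre F i c) S) →
    ∀ S a → rank F (insertAt S i (just a)) ≡ + 1 +ℤ rank (fibre F i a) S
  rank-insertAt-exchange nonempty-true nonempty-false exchange S a =
    rank-insertAt S (just a) (a , fibre-a-nonempty a , cong (_+ℤ rank (fibre F i a) S) (agreement-refl a))
                  (λ c _ → upper a c)
    where
    fibre-a-nonempty : ∀ c → NonEmpty (fibre F i c)
    fibre-a-nonempty true  = nonempty-true
    fibre-a-nonempty false = nonempty-false
    upper : ∀ a c → agreement a c +ℤ rank (fibre F i c) S ≤ℤ + 1 +ℤ rank (fibre F i a) S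
    upper true  true  = ℤP.≤-refl
    upper true  false = -1+x≤1+y (rank (fibre F i false) S) (rank (fibre F i true) S) (exchange S true)
    upper false true  = -1+x≤1+y (rank (fibre F i true) S) (rank (fibre F i false) S) (exchange S false)
    upper false false = ℤP.≤-refl

  fibre-not-constant : ∀ {c} → IsConstantAt F i c → ∀ B → fibre F i (not c) B ≡ false
  fibre-not-constant {c} constant B with F (insertAt B i (not c)) in FB
  ... | false = refl
  ... | true  = ⊥-elim (not-¬ refl (sym (trans (sym (insertAt-lookup B i (not c))) (constant _ FB))))

  projMinor-constant : ∀ {c} → IsConstantAt F i c → ∀ B → projMinor F i B ≡ fibre F i c B
  projMinor-constant {true}  constant B rewrite fibre-not-constant constant B = ∨-identityʳ _
  projMinor-constant {false} constant B rewrite fibre-not-constant constant B = refl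

  deletion-constant : ∀ {c} → IsConstantAt F i c → ∀ B → deletion F i B ≡ fibre F i c B
  deletion-constant {c} constant B with hasSign F i false in has
  ... | false = projMinor-constant constant B
  ... | true with hasSign-sound has
  ...   | B′ , FB′ with trans (sym (insertAt-lookup B′ i false)) (constant _ FB′)
  ...     | refl = refl

dot-zipWith : ∀ {n} (u w : Vec ℤ n) B → dot (zipWith _+ℤ_ u w) B ≡ dot u B +ℤ dot w B
dot-zipWith []      []      []      = refl
dot-zipWith (x ∷ u) (y ∷ w) (b ∷ B) = begin-equality
  (x +ℤ y) *ℤ sgn b +ℤ dot (zipWith _+ℤ_ u w) B  ≡⟨ cong ((x +ℤ y) *ℤ sgn b +ℤ_) (dot-zipWith u w B) ⟩
  (x +ℤ y) *ℤ sgn b +ℤ (dot u B +ℤ dot w B)      ≡⟨ distrib x y (sgn b) (dot u B) (dot w B) ⟩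
  (x *ℤ sgn b +ℤ dot u B) +ℤ (y *ℤ sgn b +ℤ dot w B) ∎
  where
  open ℤP.≤-Reasoning
  distrib : ∀ x y s U W → (x +ℤ y) *ℤ s +ℤ (U +ℤ W) ≡ (x *ℤ s +ℤ U) +ℤ (y *ℤ s +ℤ W)
  distrib = solve-∀

dot-scale : ∀ {n} k (u : Vec ℤ n) B → dot (vmap (k *ℤ_) u) B ≡ k *ℤ dot u B
dot-scale k []      []      = sym (ℤP.*-zeroʳ k)
dot-scale k (x ∷ u) (b ∷ B) = begin-equality
  (k *ℤ x) *ℤ sgn b +ℤ dot (vmap (k *ℤ_) u) B  ≡⟨ cong ((k *ℤ x) *ℤ sgn b +ℤ_) (dot-scale k u B) ⟩
  (k *ℤ x) *ℤ sgn b +ℤ k *ℤ dot u B            ≡⟨ distrib k x (sgn b) (dot u B) ⟩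
  k *ℤ (x *ℤ sgn b +ℤ dot u B)                 ∎
  where
  open ℤP.≤-Reasoning
  distrib : ∀ k x s U → (k *ℤ x) *ℤ s +ℤ k *ℤ U ≡ k *ℤ (x *ℤ s +ℤ U)
  distrib = solve-∀

dot-zero : ∀ {n} (B : Vec Bool n) → dot (replicate n 0ℤ) B ≡ 0ℤ
dot-zero []      = refl
dot-zero (b ∷ B) = trans (ℤP.+-identityˡ _) (dot-zero B)

dot-unit : ∀ {n} (i : Fin (suc n)) d (B : Vec Bool (suc n)) →
           dot (insertAt (replicate n 0ℤ) i d) B ≡ d *ℤ sgn (lookup B i)
dot-unit             fzero    d (b ∷ B) = trans (cong (d *ℤ sgn b +ℤ_) (dot-zero B)) (ℤP.+-identityʳ _)
dot-unit {suc n}     (fsuc i) d (b ∷ B) = trans (ℤP.+-identityˡ _) (dot-unit i d B)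

weight : ∀ {n} → Vec (Maybe Bool) n → Vec ℤ n
weight []           = []
weight (nothing ∷ S) = 0ℤ ∷ weight S
weight (just s ∷ S)  = sgn s ∷ weight S

dot-weight : ∀ {n} (S : Vec (Maybe Bool) n) B → dot (weight S) B ≡ pairVal S B
dot-weight []            []      = refl
dot-weight (nothing ∷ S) (b ∷ B) = trans (ℤP.+-identityˡ _) (dot-weight S B)
dot-weight (just s ∷ S)  (b ∷ B) = cong₂ _+ℤ_ (sgn*sgn s b) (dot-weight S B)
  where
  sgn*sgn : ∀ s b → sgn s *ℤ sgn b ≡ agreement s b
  sgn*sgn true  true  = refl
  sgn*sgn true  false = refl
  sgn*sgn false true  = refl
  sgn*sgn false false = refl

tieBreak : (m : ℕ) → Vec ℤ m
tieBreak zero    = []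
tieBreak (suc m) = + 1 ∷ vmap (+ 3 *ℤ_) (tieBreak m)

tieBound : ℕ → ℕ
tieBound zero    = 0
tieBound (suc m) = suc (3 ℕ.* tieBound m)

dot-tieBreak-∷ : ∀ {m} b (B : Vec Bool m) → dot (tieBreak (suc m)) (b ∷ B) ≡ sgn b +ℤ + 3 *ℤ dot (tieBreak m) B
dot-tieBreak-∷ {m} b B = cong₂ _+ℤ_ (ℤP.*-identityˡ (sgn b)) (dot-scale (+ 3) (tieBreak m) B)

+tieBound-suc : ∀ m → + tieBound (suc m) ≡ + 1 +ℤ + 3 *ℤ + tieBound m
+tieBound-suc m = trans (ℤP.pos-+ 1 (3 ℕ.* tieBound m)) (cong (+ 1 +ℤ_) (ℤP.pos-* 3 (tieBound m)))

dot-tieBreak≤ : ∀ {m} (B : Vec Bool m) → dot (tieBreak m) B ≤ℤ + tieBound m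
dot-tieBreak≤ []            = ℤP.≤-refl
dot-tieBreak≤ {suc m} (b ∷ B) = begin
  dot (tieBreak (suc m)) (b ∷ B)          ≡⟨ dot-tieBreak-∷ b B ⟩
  sgn b +ℤ + 3 *ℤ dot (tieBreak m) B      ≤⟨ ℤP.+-mono-≤ (sgn≤1 b) (ℤP.*-monoˡ-≤-nonNeg (+ 3) (dot-tieBreak≤ B)) ⟩
  + 1 +ℤ + 3 *ℤ + tieBound m              ≡⟨ sym (+tieBound-suc m) ⟩
  + tieBound (suc m)                      ∎
  where
  open ℤP.≤-Reasoning
  sgn≤1 : ∀ b → sgn b ≤ℤ + 1
  sgn≤1 true  = ℤP.≤-refl
  sgn≤1 false = -≤+

-tieBound≤dot-tieBreak : ∀ {m} (B : Vec Bool m) → -ℤ + tieBound m ≤ℤ dot (tieBreak m) B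
-tieBound≤dot-tieBreak []            = ℤP.≤-refl
-tieBound≤dot-tieBreak {suc m} (b ∷ B) = begin
  -ℤ + tieBound (suc m)                   ≡⟨ cong -ℤ_ (+tieBound-suc m) ⟩
  -ℤ (+ 1 +ℤ + 3 *ℤ + tieBound m)         ≡⟨ neg-distrib (+ tieBound m) ⟩
  -[1+ 0 ] +ℤ + 3 *ℤ -ℤ + tieBound m      ≤⟨ ℤP.+-mono-≤ (-1≤sgn b) (ℤP.*-monoˡ-≤-nonNeg (+ 3) (-tieBound≤dot-tieBreak B)) ⟩
  sgn b +ℤ + 3 *ℤ dot (tieBreak m) B      ≡⟨ sym (dot-tieBreak-∷ b B) ⟩
  dot (tieBreak (suc m)) (b ∷ B)          ∎
  where
  open ℤP.≤-Reasoning
  -1≤sgn : ∀ b → -[1+ 0 ] ≤ℤ sgn b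
  -1≤sgn true  = -≤+
  -1≤sgn false = ℤP.≤-refl
  neg-distrib : ∀ T → -ℤ (+ 1 +ℤ + 3 *ℤ T) ≡ -[1+ 0 ] +ℤ + 3 *ℤ -ℤ T
  neg-distrib = solve-∀

3*z≢2 : ∀ z → + 3 *ℤ z ≢ + 2
3*z≢2 z 3z≡2 with ∣⇒≤ (subst (3 ℕ∣_) (trans (sym (ℤP.abs-* (+ 3) z)) (cong ℤ.∣_∣ 3z≡2)) (m∣m*n ℤ.∣ z ∣))
... | s≤s (s≤s ())

tieBreak-injective : ∀ {m} (B C : Vec Bool m) → dot (tieBreak m) B ≡ dot (tieBreak m) C → B ≡ C
tieBreak-injective []      []      _ = refl
tieBreak-injective {suc m} (b ∷ B) (c ∷ C) eq =
  heads b c (trans (sym (dot-tieBreak-∷ b B)) (trans eq (dot-tieBreak-∷ c C)))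
  where
  X Y : ℤ
  X = dot (tieBreak m) B
  Y = dot (tieBreak m) C
  tails : ∀ s → s +ℤ + 3 *ℤ X ≡ s +ℤ + 3 *ℤ Y → B ≡ C
  tails s eq = tieBreak-injective B C (ℤP.*-cancelˡ-≡ (+ 3) X Y (+ℤ-cancelˡ s _ _ eq))
  gap : ∀ X Y → + 1 +ℤ + 3 *ℤ X ≡ -[1+ 0 ] +ℤ + 3 *ℤ Y → + 3 *ℤ (Y -ℤ X) ≡ + 2
  gap X Y eq = begin-equality
    + 3 *ℤ (Y -ℤ X)                                            ≡⟨ rearrange X Y ⟩
    (-[1+ 0 ] +ℤ + 3 *ℤ Y) -ℤ (+ 1 +ℤ + 3 *ℤ X) +ℤ + 2         ≡⟨ cong (λ z → z -ℤ (+ 1 +ℤ + 3 *ℤ X) +ℤ + 2) (sym eq) ⟩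
    (+ 1 +ℤ + 3 *ℤ X) -ℤ (+ 1 +ℤ + 3 *ℤ X) +ℤ + 2              ≡⟨ cong (_+ℤ + 2) (ℤP.+-inverseʳ (+ 1 +ℤ + 3 *ℤ X)) ⟩
    + 2                                                        ∎
    where
    open ℤP.≤-Reasoning
    rearrange : ∀ X Y → + 3 *ℤ (Y -ℤ X) ≡ (-[1+ 0 ] +ℤ + 3 *ℤ Y) -ℤ (+ 1 +ℤ + 3 *ℤ X) +ℤ + 2
    rearrange = solve-∀
  heads : ∀ b c → sgn b +ℤ + 3 *ℤ X ≡ sgn c +ℤ + 3 *ℤ Y → b ∷ B ≡ c ∷ C
  heads true  true  eq = cong (true ∷_) (tails (+ 1) eq)
  heads false false eq = cong (false ∷_) (tails -[1+ 0 ] eq)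
  heads true  false eq = ⊥-elim (3*z≢2 (Y -ℤ X) (gap X Y eq))
  heads false true  eq = ⊥-elim (3*z≢2 (X -ℤ Y) (gap Y X (sym eq)))

tieScale : ℕ → ℤ
tieScale T = + suc (2 ℕ.* T)

tieScale-dominates : ∀ T {a b s t} → -ℤ + T ≤ℤ s → t ≤ℤ + T →
                     tieScale T *ℤ a +ℤ s ≤ℤ tieScale T *ℤ b +ℤ t → a ≤ℤ b
tieScale-dominates T {a} {b} {s} {t} -T≤s t≤T Ka+s≤Kb+t with a ℤP.≤? b
... | yes a≤b = a≤b
... | no  a≰b = ⊥-elim (ℤP.<⇒≱ (ℤP.suc[i]≤j⇒i<j (begin
  + 1 +ℤ (K *ℤ b +ℤ t)      ≤⟨ ℤP.+-monoʳ-≤ (+ 1) (ℤP.+-monoʳ-≤ (K *ℤ b) t≤T) ⟩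
  + 1 +ℤ (K *ℤ b +ℤ + T)    ≡⟨ shift ⟩
  K *ℤ (+ 1 +ℤ b) -ℤ + T    ≤⟨ ℤP.+-monoˡ-≤ (-ℤ + T) (ℤP.*-monoˡ-≤-nonNeg K (ℤP.i<j⇒suc[i]≤j (ℤP.≰⇒> a≰b))) ⟩
  K *ℤ a -ℤ + T             ≤⟨ ℤP.+-monoʳ-≤ (K *ℤ a) -T≤s ⟩
  K *ℤ a +ℤ s               ∎)) Ka+s≤Kb+t)
  where
  open ℤP.≤-Reasoning
  K : ℤ
  K = tieScale T
  shift : + 1 +ℤ (K *ℤ b +ℤ + T) ≡ K *ℤ (+ 1 +ℤ b) -ℤ + T
  shift = subst (λ K → + 1 +ℤ (K *ℤ b +ℤ + T) ≡ K *ℤ (+ 1 +ℤ b) -ℤ + T)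
                (sym (trans (ℤP.pos-+ 1 (2 ℕ.* T)) (cong (+ 1 +ℤ_) (ℤP.pos-* 2 T)))) (ring (+ T) b)
    where
    ring : ∀ T b → + 1 +ℤ ((+ 1 +ℤ + 2 *ℤ T) *ℤ b +ℤ T) ≡ (+ 1 +ℤ + 2 *ℤ T) *ℤ (+ 1 +ℤ b) -ℤ T
    ring = solve-∀

-- The scale 2·tieBound m + 1 exceeds the spread of the tie-breaking part, so this functional refines pairVal X;
-- the ternary weights of tieBreak make it injective on sign vectors.
perturbation : ∀ {m} → Vec (Maybe Bool) m → Vec ℤ m
perturbation {m} X = zipWith _+ℤ_ (vmap (tieScale (tieBound m) *ℤ_) (weight X)) (tieBreak m)

module _ {m} (X : Vec (Maybe Bool) m) where

  dot-perturbation : ∀ B → dot (perturbation X) B ≡ tieScale (tieBound m) *ℤ pairVal X B +ℤ dot (tieBreak m) B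
  dot-perturbation B = begin-equality
    dot (perturbation X) B
      ≡⟨ dot-zipWith (vmap (tieScale (tieBound m) *ℤ_) (weight X)) (tieBreak m) B ⟩
    dot (vmap (tieScale (tieBound m) *ℤ_) (weight X)) B +ℤ dot (tieBreak m) B
      ≡⟨ cong (_+ℤ dot (tieBreak m) B) (dot-scale (tieScale (tieBound m)) (weight X) B) ⟩
    tieScale (tieBound m) *ℤ dot (weight X) B +ℤ dot (tieBreak m) B
      ≡⟨ cong (λ x → tieScale (tieBound m) *ℤ x +ℤ dot (tieBreak m) B) (dot-weight X B) ⟩
    tieScale (tieBound m) *ℤ pairVal X B +ℤ dot (tieBreak m) B
      ∎
    where open ℤP.≤-Reasoning

  perturbation-refines : ∀ B C → dot (perturbation X) B ≤ℤ dot (perturbation X) C → pairVal X B ≤ℤ pairVal X C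
  perturbation-refines B C ΦB≤ΦC = tieScale-dominates (tieBound m)
    (-tieBound≤dot-tieBreak B) (dot-tieBreak≤ C)
    (subst₂ _≤ℤ_ (dot-perturbation B) (dot-perturbation C) ΦB≤ΦC)

  perturbation-injective : ∀ B C → dot (perturbation X) B ≡ dot (perturbation X) C → B ≡ C
  perturbation-injective B C ΦB≡ΦC = tieBreak-injective B C
    (+ℤ-cancelˡ (tieScale (tieBound m) *ℤ pairVal X B) (dot (tieBreak m) B) (dot (tieBreak m) C) (begin-equality
    tieScale (tieBound m) *ℤ pairVal X B +ℤ dot (tieBreak m) B  ≡⟨ sym (dot-perturbation B) ⟩
    dot (perturbation X) B                                      ≡⟨ ΦB≡ΦC ⟩
    dot (perturbation X) C                                      ≡⟨ dot-perturbation C ⟩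
    tieScale (tieBound m) *ℤ pairVal X C +ℤ dot (tieBreak m) C
      ≡⟨ cong (λ x → tieScale (tieBound m) *ℤ x +ℤ dot (tieBreak m) C) (sym pairVal≡) ⟩
    tieScale (tieBound m) *ℤ pairVal X B +ℤ dot (tieBreak m) C  ∎))
    where
    open ℤP.≤-Reasoning
    pairVal≡ : pairVal X B ≡ pairVal X C
    pairVal≡ = ℤP.≤-antisym (perturbation-refines B C (ℤP.≤-reflexive ΦB≡ΦC))
                            (perturbation-refines C B (ℤP.≤-reflexive (sym ΦB≡ΦC)))

IsMaximiser : ∀ {n} → SetSystem n → (Vec Bool n → ℤ) → Vec Bool n → Set
IsMaximiser G f y = G y ≡ true × (∀ C → G C ≡ true → f C ≤ℤ f y)

maximiser : ∀ {n} {G : SetSystem n} (f : Vec Bool n → ℤ) → NonEmpty G → ∃ (IsMaximiser G f)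
maximiser {G = G} f (B₀ , GB₀) =
  argmax f B₀ (feasibleList G) ,
  argmax-all f {P = λ y → G y ≡ true} GB₀ (All.tabulate (feasibleList-sound {F = G})) ,
  λ C GC → All.lookup (f[xs]≤f[argmax] B₀ (feasibleList G)) (∈-feasibleList GC)

fibreDot : ∀ {n} → Vec ℤ (suc n) → Fin (suc n) → Bool → Vec Bool n → ℤ
fibreDot φ i c B = dot φ (insertAt B i c)

module _ {n} (F : SetSystem (suc n)) (i : Fin (suc n)) (φ : Vec ℤ (suc n))
         (φ-injective : ∀ B C → dot φ B ≡ dot φ C → B ≡ C) where

  -- The edge is certified by ψ = 2φ + d·e_i, with d chosen so that ψ agrees on the two maximisers; on each fibre ψ
  -- is a strictly increasing function of φ.
  fibre-maximisers-edge : ∀ {f t} → IsMaximiser (fibre F i false) (fibreDot φ i false) f →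
                          IsMaximiser (fibre F i true) (fibreDot φ i true) t →
                          IsEdge F (insertAt f i false) (insertAt t i true)
  fibre-maximisers-edge {f} {t} f-max@(Ff , _) t-max@(Ft , _) = Ff , Ft , f≢t , ψ , ψf≡ψt , face
    where
    open ℤP.≤-Reasoning
    d : ℤ
    d = fibreDot φ i false f -ℤ fibreDot φ i true t
    ψ : Vec ℤ (suc n)
    ψ = zipWith _+ℤ_ (vmap (+ 2 *ℤ_) φ) (insertAt (replicate n 0ℤ) i d)

    dot-ψ : ∀ c C → dot ψ (insertAt C i c) ≡ + 2 *ℤ fibreDot φ i c C +ℤ d *ℤ sgn c
    dot-ψ c C = begin-equality
      dot ψ (insertAt C i c)
        ≡⟨ dot-zipWith (vmap (+ 2 *ℤ_) φ) _ _ ⟩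
      dot (vmap (+ 2 *ℤ_) φ) (insertAt C i c) +ℤ dot (insertAt (replicate n 0ℤ) i d) (insertAt C i c)
        ≡⟨ cong₂ _+ℤ_ (dot-scale (+ 2) φ _) (dot-unit i d _) ⟩
      + 2 *ℤ fibreDot φ i c C +ℤ d *ℤ sgn (lookup (insertAt C i c) i)
        ≡⟨ cong (λ c′ → + 2 *ℤ fibreDot φ i c C +ℤ d *ℤ sgn c′) (insertAt-lookup C i c) ⟩
      + 2 *ℤ fibreDot φ i c C +ℤ d *ℤ sgn c
        ∎

    ψf≡ψt : dot ψ (insertAt f i false) ≡ dot ψ (insertAt t i true)
    ψf≡ψt = trans (dot-ψ false f) (trans (balance (fibreDot φ i false f) (fibreDot φ i true t)) (sym (dot-ψ true t)))
      where
      balance : ∀ x y → + 2 *ℤ x +ℤ (x -ℤ y) *ℤ -[1+ 0 ] ≡ + 2 *ℤ y +ℤ (x -ℤ y) *ℤ + 1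
      balance = solve-∀

    f≢t : insertAt f i false ≢ insertAt t i true
    f≢t f≡t with trans (sym (insertAt-lookup f i false)) (trans (cong (λ B → lookup B i) f≡t) (insertAt-lookup t i true))
    ... | ()

    level : ∀ c {y} → IsMaximiser (fibre F i c) (fibreDot φ i c) y → ∀ C → F (insertAt C i c) ≡ true →
            dot ψ (insertAt C i c) ≤ℤ dot ψ (insertAt y i c) ×
            (dot ψ (insertAt C i c) ≡ dot ψ (insertAt y i c) → insertAt C i c ≡ insertAt y i c)
    level c {y} (_ , y-max) C FC =
      subst₂ _≤ℤ_ (sym (dot-ψ c C)) (sym (dot-ψ c y))
             (ℤP.+-monoˡ-≤ (d *ℤ sgn c) (ℤP.*-monoˡ-≤-nonNeg (+ 2) (y-max C FC))) ,
      λ ψC≡ψy → φ-injective _ _ (ℤP.*-cancelˡ-≡ (+ 2) _ _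
                  (+ℤ-cancelʳ (d *ℤ sgn c) _ _ (trans (sym (dot-ψ c C)) (trans ψC≡ψy (dot-ψ c y)))))

    face : ∀ C → F C ≡ true → dot ψ C ≤ℤ dot ψ (insertAt f i false) ×
           (dot ψ C ≡ dot ψ (insertAt f i false) → C ≡ insertAt f i false ⊎ C ≡ insertAt t i true)
    face C FC with insertAtView i C
    ... | insertAt-view C′ false with level false f-max C′ FC
    ...   | ψC≤ψf , ψC≡ψf⇒C≡f = ψC≤ψf , inj₁ ∘ ψC≡ψf⇒C≡f
    face C FC | insertAt-view C′ true with level true t-max C′ FC
    ...   | ψC≤ψt , ψC≡ψt⇒C≡t =
      subst (dot ψ (insertAt C′ i true) ≤ℤ_) (sym ψf≡ψt) ψC≤ψt , λ ψC≡ψf → inj₂ (ψC≡ψt⇒C≡t (trans ψC≡ψf ψf≡ψt))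

mismatch : Bool → Bool → ℕ
mismatch a b = if (a ≟B b) .does then 0 else 1

mismatch-comm : ∀ a b → mismatch a b ≡ mismatch b a
mismatch-comm true  true  = refl
mismatch-comm true  false = refl
mismatch-comm false true  = refl
mismatch-comm false false = refl

diffCount-comm : ∀ {n} (p q : Vec Bool n) → diffCount p q ≡ diffCount q p
diffCount-comm []      []      = refl
diffCount-comm (a ∷ p) (b ∷ q) = cong₂ ℕ._+_ (mismatch-comm a b) (diffCount-comm p q)

diffCount-insertAt : ∀ {n} (p q : Vec Bool n) i a b →
                     diffCount (insertAt p i a) (insertAt q i b) ≡ mismatch a b ℕ.+ diffCount p q
diffCount-insertAt p       q       fzero    a b = refl
diffCount-insertAt (x ∷ p) (y ∷ q) (fsuc i) a b = begin-equality
  mismatch x y ℕ.+ diffCount (insertAt p i a) (insertAt q i b)  ≡⟨ cong (mismatch x y ℕ.+_) (diffCount-insertAt p q i a b) ⟩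
  mismatch x y ℕ.+ (mismatch a b ℕ.+ diffCount p q)             ≡⟨ +ℕ-leftComm (mismatch x y) (mismatch a b) _ ⟩
  mismatch a b ℕ.+ (mismatch x y ℕ.+ diffCount p q)             ∎
  where open ℕP.≤-Reasoning

agreement≤agreement+2*mismatch : ∀ s a b → agreement s a ≤ℤ agreement s b +ℤ + 2 *ℤ + mismatch a b
agreement≤agreement+2*mismatch true  true  true  = ℤP.≤-refl
agreement≤agreement+2*mismatch true  true  false = ℤP.≤-refl
agreement≤agreement+2*mismatch true  false true  = -≤+
agreement≤agreement+2*mismatch true  false false = ℤP.≤-refl
agreement≤agreement+2*mismatch false true  true  = ℤP.≤-refl
agreement≤agreement+2*mismatch false true  false = -≤+
agreement≤agreement+2*mismatch false false true  = ℤP.≤-refl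
agreement≤agreement+2*mismatch false false false = ℤP.≤-refl

pairVal≤pairVal+2*diffCount : ∀ {n} (S : Vec (Maybe Bool) n) p q →
                              pairVal S p ≤ℤ pairVal S q +ℤ + 2 *ℤ + diffCount p q
pairVal≤pairVal+2*diffCount []            []      []      = ℤP.≤-refl
pairVal≤pairVal+2*diffCount (nothing ∷ S) (a ∷ p) (b ∷ q) = begin
  pairVal S p                                          ≤⟨ pairVal≤pairVal+2*diffCount S p q ⟩
  pairVal S q +ℤ + 2 *ℤ + diffCount p q
    ≤⟨ ℤP.+-monoʳ-≤ (pairVal S q) (ℤP.*-monoˡ-≤-nonNeg (+ 2) (+≤+ (ℕP.m≤n+m _ (mismatch a b)))) ⟩
  pairVal S q +ℤ + 2 *ℤ + (mismatch a b ℕ.+ diffCount p q) ∎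
  where open ℤP.≤-Reasoning
pairVal≤pairVal+2*diffCount (just s ∷ S)  (a ∷ p) (b ∷ q) = begin
  agreement s a +ℤ pairVal S p
    ≤⟨ ℤP.+-mono-≤ (agreement≤agreement+2*mismatch s a b) (pairVal≤pairVal+2*diffCount S p q) ⟩
  (agreement s b +ℤ + 2 *ℤ + mismatch a b) +ℤ (pairVal S q +ℤ + 2 *ℤ + diffCount p q)
    ≡⟨ regroup (agreement s b) (pairVal S q) (+ mismatch a b) (+ diffCount p q) ⟩
  (agreement s b +ℤ pairVal S q) +ℤ + 2 *ℤ (+ mismatch a b +ℤ + diffCount p q)
    ≡⟨ cong (λ k → (agreement s b +ℤ pairVal S q) +ℤ + 2 *ℤ k) (sym (ℤP.pos-+ (mismatch a b) (diffCount p q))) ⟩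
  (agreement s b +ℤ pairVal S q) +ℤ + 2 *ℤ + (mismatch a b ℕ.+ diffCount p q) ∎
  where
  open ℤP.≤-Reasoning
  regroup : ∀ x y u v → (x +ℤ + 2 *ℤ u) +ℤ (y +ℤ + 2 *ℤ v) ≡ (x +ℤ y) +ℤ + 2 *ℤ (u +ℤ v)
  regroup = solve-∀

module _ {n} (D : DeltaMatroid (suc n)) (i : Fin (suc n)) (S : Vec (Maybe Bool) n) where

  private
    φ : Vec ℤ (suc n)
    φ = perturbation (insertAt S i nothing)

  rank-fibre-maximiser : ∀ c {y} → IsMaximiser (fibre (feasible D) i c) (fibreDot φ i c) y →
                         rank (fibre (feasible D) i c) S ≡ pairVal S y
  rank-fibre-maximiser c {y} (Fy , y-max) = rank-unique _ S (y , Fy , refl) λ C FC →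
    subst₂ _≤ℤ_ (pairVal-insertAt-nothing C) (pairVal-insertAt-nothing y)
           (perturbation-refines (insertAt S i nothing) _ _ (y-max C FC))
    where
    pairVal-insertAt-nothing : ∀ B → pairVal (insertAt S i nothing) (insertAt B i c) ≡ pairVal S B
    pairVal-insertAt-nothing B = trans (pairVal-insertAt S i nothing B c) (ℤP.+-identityˡ _)

  fibre-rank-exchange : NonEmpty (fibre (feasible D) i true) → NonEmpty (fibre (feasible D) i false) →
                        ∀ c → rank (fibre (feasible D) i (not c)) S ≤ℤ + 2 +ℤ rank (fibre (feasible D) i c) S
  fibre-rank-exchange nonempty-true nonempty-false c
    with maximiser (fibreDot φ i false) nonempty-false | maximiser (fibreDot φ i true) nonempty-true
  ... | f , f-max | t , t-max = close c
    where
    edge-length : diffCount (insertAt f i false) (insertAt t i true) ℕ.≤ 2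
    edge-length = edgeDirections D _ _
      (fibre-maximisers-edge (feasible D) i φ (perturbation-injective (insertAt S i nothing)) f-max t-max)
    f~t : diffCount f t ℕ.≤ 1
    f~t = ℕP.≤-pred (subst (ℕ._≤ 2) (diffCount-insertAt f t i false true) edge-length)
    within2 : ∀ p q → diffCount p q ℕ.≤ 1 → pairVal S p ≤ℤ + 2 +ℤ pairVal S q
    within2 p q p~q = begin
      pairVal S p                          ≤⟨ pairVal≤pairVal+2*diffCount S p q ⟩
      pairVal S q +ℤ + 2 *ℤ + diffCount p q ≤⟨ ℤP.+-monoʳ-≤ (pairVal S q) (ℤP.*-monoˡ-≤-nonNeg (+ 2) (+≤+ p~q)) ⟩
      pairVal S q +ℤ + 2                   ≡⟨ ℤP.+-comm (pairVal S q) (+ 2) ⟩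
      + 2 +ℤ pairVal S q                   ∎
      where open ℤP.≤-Reasoning
    close : ∀ c → rank (fibre (feasible D) i (not c)) S ≤ℤ + 2 +ℤ rank (fibre (feasible D) i c) S
    close true  = subst₂ (λ x y → x ≤ℤ + 2 +ℤ y)
                         (sym (rank-fibre-maximiser false f-max)) (sym (rank-fibre-maximiser true t-max))
                         (within2 f t f~t)
    close false = subst₂ (λ x y → x ≤ℤ + 2 +ℤ y)
                         (sym (rank-fibre-maximiser true t-max)) (sym (rank-fibre-maximiser false f-max))
                         (within2 t f (subst (ℕ._≤ 1) (diffCount-comm f t) f~t))

module _ {n} (F : SetSystem (suc n)) (G : SetSystem n) (S : Vec (Maybe Bool) n) (i : Fin (suc n)) where

  vExp-insertAt-just : ∀ a → rank F (insertAt S i (just a)) ≡ + 1 +ℤ rank G S →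
                       vExp F (insertAt S i (just a)) ≡ vExp G S
  vExp-insertAt-just a rank≡ = cong (λ x → ⌊ ℤ.∣ x ∣ /2⌋) (begin-equality
    + size (insertAt S i (just a)) -ℤ rank F (insertAt S i (just a))  ≡⟨ cong₂ (λ s r → + s -ℤ r) (size-insertAt-just S i a) rank≡ ⟩
    + 1 +ℤ + size S -ℤ (+ 1 +ℤ rank G S)                               ≡⟨ cancel (+ size S) (rank G S) ⟩
    + size S -ℤ rank G S                                               ∎)
    where
    open ℤP.≤-Reasoning
    cancel : ∀ s r → + 1 +ℤ s -ℤ (+ 1 +ℤ r) ≡ s -ℤ r
    cancel = solve-∀

  vExp-insertAt-just-suc : ∀ a → rank F (insertAt S i (just a)) ≡ -[1+ 0 ] +ℤ rank G S → rank G S ≤ℤ + size S →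
                           vExp F (insertAt S i (just a)) ≡ suc (vExp G S)
  vExp-insertAt-just-suc a rank≡ rank≤size = cong (λ x → ⌊ ℤ.∣ x ∣ /2⌋) (begin-equality
    + size (insertAt S i (just a)) -ℤ rank F (insertAt S i (just a))  ≡⟨ cong₂ (λ s r → + s -ℤ r) (size-insertAt-just S i a) rank≡ ⟩
    + 1 +ℤ + size S -ℤ (-[1+ 0 ] +ℤ rank G S)                          ≡⟨ shift (+ size S) (rank G S) ⟩
    + 2 +ℤ (+ size S -ℤ rank G S)                                      ≡⟨ cong (+ 2 +ℤ_) (sym (ℤP.0≤i⇒+∣i∣≡i (ℤP.i≤j⇒0≤j-i rank≤size))) ⟩
    + 2 +ℤ + ℤ.∣ + size S -ℤ rank G S ∣                                ∎)
    where
    open ℤP.≤-Reasoning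
    shift : ∀ s r → + 1 +ℤ s -ℤ (-[1+ 0 ] +ℤ r) ≡ + 2 +ℤ (s -ℤ r)
    shift = solve-∀

  vExp-insertAt-nothing : rank F (insertAt S i nothing) ≡ rank G S → vExp F (insertAt S i nothing) ≡ vExp G S
  vExp-insertAt-nothing rank≡ = cong₂ (λ s r → ⌊ ℤ.∣ + s -ℤ r ∣ /2⌋) (size-insertAt-nothing S i) rank≡

module _ {c ℓ} (R : CommutativeSemiring c ℓ) where
  open CommutativeSemiring R
    using (Carrier; _≈_; _+_; _*_; 0#; 1#; setoid; +-comm; +-assoc; *-assoc; distribˡ; distribʳ;
           +-identityˡ; +-identityʳ; *-identityˡ; zeroʳ; +-cong; +-congˡ; +-congʳ)
    renaming (refl to ≈-refl; sym to ≈-sym; trans to ≈-trans; reflexive to ≈-reflexive)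
  open import Relation.Binary.Reasoning.Setoid setoid
  open import Algebra.Properties.CommutativeSemigroup (CommutativeSemiring.*-commutativeSemigroup R)
    using () renaming (x∙yz≈y∙xz to *-leftComm)

  sumOver : ∀ {X : Set} → (X → Carrier) → List X → Carrier
  sumOver f xs = foldr _+_ 0# (map f xs)

  sumOver-cong : ∀ {X : Set} {f g : X → Carrier} → (∀ x → f x ≈ g x) → ∀ xs → sumOver f xs ≈ sumOver g xs
  sumOver-cong f≈g []       = ≈-refl
  sumOver-cong f≈g (x ∷ xs) = +-cong (f≈g x) (sumOver-cong f≈g xs)

  sumOver-++ : ∀ {X : Set} (f : X → Carrier) xs ys → sumOver f (xs ++ ys) ≈ sumOver f xs + sumOver f ys
  sumOver-++ f []       ys = ≈-sym (+-identityˡ _)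
  sumOver-++ f (x ∷ xs) ys = ≈-trans (+-congˡ (sumOver-++ f xs ys)) (≈-sym (+-assoc _ _ _))

  sumOver-concatMap : ∀ {X Y : Set} (f : Y → Carrier) (g : X → List Y) xs →
                      sumOver f (concatMap g xs) ≈ sumOver (sumOver f ∘ g) xs
  sumOver-concatMap f g []       = ≈-refl
  sumOver-concatMap f g (x ∷ xs) = ≈-trans (sumOver-++ f (g x) (concatMap g xs)) (+-congˡ (sumOver-concatMap f g xs))

  +-interchange : ∀ a b c d → (a + b) + (c + d) ≈ (a + c) + (b + d)
  +-interchange a b c d = begin
    (a + b) + (c + d)  ≈⟨ +-assoc a b (c + d) ⟩
    a + (b + (c + d))  ≈⟨ +-congˡ (≈-sym (+-assoc b c d)) ⟩
    a + ((b + c) + d)  ≈⟨ +-congˡ (+-congʳ (+-comm b c)) ⟩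
    a + ((c + b) + d)  ≈⟨ +-congˡ (+-assoc c b d) ⟩
    a + (c + (b + d))  ≈⟨ ≈-sym (+-assoc a c (b + d)) ⟩
    (a + c) + (b + d)  ∎

  sumOver-+ : ∀ {X : Set} (f g : X → Carrier) xs → sumOver (λ x → f x + g x) xs ≈ sumOver f xs + sumOver g xs
  sumOver-+ f g []       = ≈-sym (+-identityˡ _)
  sumOver-+ f g (x ∷ xs) = ≈-trans (+-congˡ (sumOver-+ f g xs)) (+-interchange _ _ _ _)

  sumOver-*ˡ : ∀ {X : Set} k (f : X → Carrier) xs → sumOver (λ x → k * f x) xs ≈ k * sumOver f xs
  sumOver-*ˡ k f []       = ≈-sym (zeroʳ k)
  sumOver-*ˡ k f (x ∷ xs) = ≈-trans (+-congˡ (sumOver-*ˡ k f xs)) (≈-sym (distribˡ k _ _))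

  splitAt : ∀ {n} → (Vec (Maybe Bool) (suc n) → Carrier) → Fin (suc n) → Vec (Maybe Bool) n → Carrier
  splitAt g i S = g (insertAt S i (just true)) + (g (insertAt S i (just false)) + g (insertAt S i nothing))

  sumOver-allAdm-head : ∀ {n} (g : Vec (Maybe Bool) (suc n) → Carrier) →
                        sumOver g (allAdm (suc n)) ≈ sumOver (splitAt g fzero) (allAdm n)
  sumOver-allAdm-head {n} g = ≈-trans (sumOver-concatMap g _ (allAdm n))
                                      (sumOver-cong (λ S → +-congˡ (+-congˡ (+-identityʳ _))) (allAdm n))

  sumOver-allAdm-insertAt : ∀ n (g : Vec (Maybe Bool) (suc n) → Carrier) i →
                            sumOver g (allAdm (suc n)) ≈ sumOver (splitAt g i) (allAdm n)
  sumOver-allAdm-insertAt n       g fzero    = sumOver-allAdm-head g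
  sumOver-allAdm-insertAt (suc n) g (fsuc i) = begin
    sumOver g (allAdm (suc (suc n)))                           ≈⟨ sumOver-allAdm-head g ⟩
    sumOver (splitAt g fzero) (allAdm (suc n))                 ≈⟨ sumOver-allAdm-insertAt n (splitAt g fzero) i ⟩
    sumOver (splitAt (splitAt g fzero) i) (allAdm n)           ≈⟨ sumOver-cong (λ _ → transpose _ _ _ _ _ _ _ _ _) (allAdm n) ⟩
    sumOver (splitAt (splitAt g (fsuc i)) fzero) (allAdm n)    ≈⟨ sumOver-allAdm-head (splitAt g (fsuc i)) ⟨
    sumOver (splitAt g (fsuc i)) (allAdm (suc n))              ∎
    where
    transpose : ∀ x₁ x₂ x₃ y₁ y₂ y₃ z₁ z₂ z₃ →
      (x₁ + (x₂ + x₃)) + ((y₁ + (y₂ + y₃)) + (z₁ + (z₂ + z₃))) ≈ (x₁ + (y₁ + z₁)) + ((x₂ + (y₂ + z₂)) + (x₃ + (y₃ + z₃)))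
    transpose x₁ x₂ x₃ y₁ y₂ y₃ z₁ z₂ z₃ = begin
      (x₁ + (x₂ + x₃)) + ((y₁ + (y₂ + y₃)) + (z₁ + (z₂ + z₃)))   ≈⟨ +-congˡ (+-interchange y₁ (y₂ + y₃) z₁ (z₂ + z₃)) ⟩
      (x₁ + (x₂ + x₃)) + ((y₁ + z₁) + ((y₂ + y₃) + (z₂ + z₃)))   ≈⟨ +-interchange x₁ (x₂ + x₃) (y₁ + z₁) _ ⟩
      (x₁ + (y₁ + z₁)) + ((x₂ + x₃) + ((y₂ + y₃) + (z₂ + z₃)))   ≈⟨ +-congˡ (+-congˡ (+-interchange y₂ y₃ z₂ z₃)) ⟩
      (x₁ + (y₁ + z₁)) + ((x₂ + x₃) + ((y₂ + z₂) + (y₃ + z₃)))   ≈⟨ +-congˡ (+-interchange x₂ x₃ (y₂ + z₂) (y₃ + z₃)) ⟩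
      (x₁ + (y₁ + z₁)) + ((x₂ + (y₂ + z₂)) + (x₃ + (y₃ + z₃)))   ∎

  module _ (u v : Carrier) where

    term : ∀ {N} → SetSystem N → Vec (Maybe Bool) N → Carrier
    term {N} F S = pow R u (N ∸ size S) * pow R v (vExp F S)

    Upoly-cong : ∀ {N} {F G : SetSystem N} → (∀ B → F B ≡ G B) → Upoly R F u v ≡ Upoly R G u v
    Upoly-cong {N} F≗G = cong (foldr _+_ 0#)
      (map-cong (λ S → cong (λ r → pow R u (N ∸ size S) * pow R v ⌊ ℤ.∣ + size S -ℤ r ∣ /2⌋) (rank-cong F≗G S))
                (allAdm N))

    Upoly-empty : (D : DeltaMatroid 0) → Upoly R (feasible D) u v ≈ 1#
    Upoly-empty D with rank-attained (feasible D) [] (nonempty D)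
    ... | [] , _ , rank≡0 = begin
      pow R u 0 * pow R v ⌊ ℤ.∣ 0ℤ -ℤ rank (feasible D) [] ∣ /2⌋ + 0#  ≈⟨ +-identityʳ _ ⟩
      1# * pow R v ⌊ ℤ.∣ 0ℤ -ℤ rank (feasible D) [] ∣ /2⌋               ≡⟨ cong (λ r → 1# * pow R v ⌊ ℤ.∣ 0ℤ -ℤ r ∣ /2⌋) (sym rank≡0) ⟩
      1# * 1#                                                           ≈⟨ *-identityˡ 1# ⟩
      1#                                                                ∎

    module _ {n} (F : SetSystem (suc n)) (G : SetSystem n) (S : Vec (Maybe Bool) n) (i : Fin (suc n)) where

      term-insertAt-just : ∀ a → rank F (insertAt S i (just a)) ≡ + 1 +ℤ rank G S →
                           term F (insertAt S i (just a)) ≈ term G S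
      term-insertAt-just a rank≡ = ≈-reflexive (cong₂ (λ k l → pow R u k * pow R v l)
        (cong (suc n ∸_) (size-insertAt-just S i a)) (vExp-insertAt-just F G S i a rank≡))

      term-insertAt-just-suc : ∀ a → rank F (insertAt S i (just a)) ≡ -[1+ 0 ] +ℤ rank G S → rank G S ≤ℤ + size S →
                               term F (insertAt S i (just a)) ≈ v * term G S
      term-insertAt-just-suc a rank≡ rank≤size = begin
        term F (insertAt S i (just a))                     ≡⟨ cong₂ (λ k l → pow R u k * pow R v l)
                                                                (cong (suc n ∸_) (size-insertAt-just S i a))
                                                                (vExp-insertAt-just-suc F G S i a rank≡ rank≤size) ⟩
        pow R u (n ∸ size S) * (v * pow R v (vExp G S))   ≈⟨ *-leftComm (pow R u (n ∸ size S)) v _ ⟩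
        v * term G S                                       ∎

      term-insertAt-nothing : rank F (insertAt S i nothing) ≡ rank G S → term F (insertAt S i nothing) ≈ u * term G S
      term-insertAt-nothing rank≡ = begin
        term F (insertAt S i nothing)                      ≡⟨ cong₂ (λ k l → pow R u k * pow R v l) u-exponent
                                                                (vExp-insertAt-nothing F G S i rank≡) ⟩
        (u * pow R u (n ∸ size S)) * pow R v (vExp G S)    ≈⟨ *-assoc u _ _ ⟩
        u * term G S                                       ∎
        where
        u-exponent : suc n ∸ size (insertAt S i nothing) ≡ suc (n ∸ size S)
        u-exponent = trans (cong (suc n ∸_) (size-insertAt-nothing S i)) (ℕP.+-∸-assoc 1 (size≤length S))

    u+v+1-distrib : ∀ T → (u + v + 1#) * T ≈ (u * T + v * T) + T
    u+v+1-distrib T = ≈-trans (distribʳ T (u + v) 1#) (+-cong (distribʳ T u v) (*-identityˡ T))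

    Upoly-nonLoop-nonColoop : ∀ {n} (D : DeltaMatroid (suc n)) i → ¬ IsLoop (feasible D) i → ¬ IsColoop (feasible D) i →
      Upoly R (feasible D) u v ≈ Upoly R (contraction (feasible D) i) u v + Upoly R (deletion (feasible D) i) u v
                                 + u * Upoly R (projMinor (feasible D) i) u v
    Upoly-nonLoop-nonColoop {n} D i nonLoop nonColoop
      rewrite contraction-nonLoop (feasible D) i nonLoop | deletion-nonColoop (feasible D) i nonColoop = begin
      sumOver (term F) (allAdm (suc n))                                    ≈⟨ sumOver-allAdm-insertAt n (term F) i ⟩
      sumOver (splitAt (term F) i) (allAdm n)                              ≈⟨ sumOver-cong split (allAdm n) ⟩
      sumOver (λ S → term F⁺ S + (term F⁻ S + u * term P S)) (allAdm n)    ≈⟨ sumOver-+ (term F⁺) _ (allAdm n) ⟩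
      Upoly R F⁺ u v + sumOver (λ S → term F⁻ S + u * term P S) (allAdm n) ≈⟨ +-congˡ (sumOver-+ (term F⁻) _ (allAdm n)) ⟩
      Upoly R F⁺ u v + (Upoly R F⁻ u v + sumOver (λ S → u * term P S) (allAdm n))
                                                                           ≈⟨ +-congˡ (+-congˡ (sumOver-*ˡ u (term P) (allAdm n))) ⟩
      Upoly R F⁺ u v + (Upoly R F⁻ u v + u * Upoly R P u v)                ≈⟨ +-assoc _ _ _ ⟨
      Upoly R F⁺ u v + Upoly R F⁻ u v + u * Upoly R P u v                  ∎
      where
      F : SetSystem (suc n)
      F = feasible D
      F⁺ F⁻ P : SetSystem n
      F⁺ = fibre F i true
      F⁻ = fibre F i false
      P = projMinor F i
      F⁺-nonempty : NonEmpty F⁺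
      F⁺-nonempty = fibre-nonempty F i true nonLoop
      F⁻-nonempty : NonEmpty F⁻
      F⁻-nonempty = fibre-nonempty F i false nonColoop
      rank-insertAt-just : ∀ S a → rank F (insertAt S i (just a)) ≡ + 1 +ℤ rank (fibre F i a) S
      rank-insertAt-just = rank-insertAt-exchange F i F⁺-nonempty F⁻-nonempty
                             (λ S → fibre-rank-exchange D i S F⁺-nonempty F⁻-nonempty)
      split : ∀ S → splitAt (term F) i S ≈ term F⁺ S + (term F⁻ S + u * term P S)
      split S = +-cong (term-insertAt-just F F⁺ S i true (rank-insertAt-just S true))
               (+-cong (term-insertAt-just F F⁻ S i false (rank-insertAt-just S false))
                       (term-insertAt-nothing F P S i (rank-insertAt-nothing F i (nonempty D) S)))

    splitAt-constant : ∀ {n} c (g : Vec (Maybe Bool) (suc n) → Carrier) i S {T} →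
      g (insertAt S i (just c)) ≈ T → g (insertAt S i (just (not c))) ≈ v * T → g (insertAt S i nothing) ≈ u * T →
      splitAt g i S ≈ (u + v + 1#) * T
    splitAt-constant true g i S {T} agree disagree omit = begin
      g (insertAt S i (just true)) + (g (insertAt S i (just false)) + g (insertAt S i nothing))
                                ≈⟨ +-cong agree (+-cong disagree omit) ⟩
      T + (v * T + u * T)       ≈⟨ +-comm T _ ⟩
      (v * T + u * T) + T       ≈⟨ +-congʳ (+-comm (v * T) (u * T)) ⟩
      (u * T + v * T) + T       ≈⟨ u+v+1-distrib T ⟨
      (u + v + 1#) * T          ∎
    splitAt-constant false g i S {T} agree disagree omit = begin
      g (insertAt S i (just true)) + (g (insertAt S i (just false)) + g (insertAt S i nothing))
                                ≈⟨ +-cong disagree (+-cong agree omit) ⟩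
      v * T + (T + u * T)       ≈⟨ +-congˡ (+-comm T (u * T)) ⟩
      v * T + (u * T + T)       ≈⟨ +-assoc (v * T) (u * T) T ⟨
      (v * T + u * T) + T       ≈⟨ +-congʳ (+-comm (v * T) (u * T)) ⟩
      (u * T + v * T) + T       ≈⟨ u+v+1-distrib T ⟨
      (u + v + 1#) * T          ∎

    Upoly-constant : ∀ {n} (D : DeltaMatroid (suc n)) i {c} → IsConstantAt (feasible D) i c →
      Upoly R (feasible D) u v ≈ (u + v + 1#) * Upoly R (deletion (feasible D) i) u v
    Upoly-constant {n} D i {c} constant rewrite Upoly-cong (deletion-constant (feasible D) i constant) = begin
      sumOver (term F) (allAdm (suc n))                       ≈⟨ sumOver-allAdm-insertAt n (term F) i ⟩
      sumOver (splitAt (term F) i) (allAdm n)                 ≈⟨ sumOver-cong split (allAdm n) ⟩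
      sumOver (λ S → (u + v + 1#) * term G S) (allAdm n)      ≈⟨ sumOver-*ˡ (u + v + 1#) (term G) (allAdm n) ⟩
      (u + v + 1#) * Upoly R G u v                            ∎
      where
      F : SetSystem (suc n)
      F = feasible D
      G : SetSystem n
      G = fibre F i c
      rank≡ : ∀ S a → rank F (insertAt S i a) ≡ contribution a c +ℤ rank G S
      rank≡ = rank-insertAt-constant F i constant (nonempty D)
      rank≤size-G : ∀ S → rank G S ≤ℤ + size S
      rank≤size-G S = rank≤size G S (constant-fibre-nonempty F i constant (nonempty D))
      agree : ∀ S → term F (insertAt S i (just c)) ≈ term G S
      agree S = term-insertAt-just F G S i c (trans (rank≡ S (just c)) (cong (_+ℤ rank G S) (agreement-refl c)))
      disagree : ∀ S → term F (insertAt S i (just (not c))) ≈ v * term G S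
      disagree S = term-insertAt-just-suc F G S i (not c)
                     (trans (rank≡ S (just (not c))) (cong (_+ℤ rank G S) (agreement-not c))) (rank≤size-G S)
      omit : ∀ S → term F (insertAt S i nothing) ≈ u * term G S
      omit S = term-insertAt-nothing F G S i (trans (rank≡ S nothing) (ℤP.+-identityˡ _))
      split : ∀ S → splitAt (term F) i S ≈ (u + v + 1#) * term G S
      split S = splitAt-constant c (term F) i S (agree S) (disagree S) (omit S)

proposition3p1 : ∀ {c ℓ : Level} (R : CommutativeSemiring c ℓ) →
    let open CommutativeSemiring R in
    (∀ (D : DeltaMatroid 0) (u v : Carrier) → Upoly R (feasible D) u v ≈ 1#) ×
    (∀ (n : ℕ) (D : DeltaMatroid (suc n)) (i : Fin (suc n)) (u v : Carrier) →
      (¬ IsLoop (feasible D) i → ¬ IsColoop (feasible D) i →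
        Upoly R (feasible D) u v
          ≈ Upoly R (contraction (feasible D) i) u v
            + Upoly R (deletion (feasible D) i) u v
            + u * Upoly R (projMinor (feasible D) i) u v) ×
      (IsLoop (feasible D) i ⊎ IsColoop (feasible D) i →
        Upoly R (feasible D) u v
          ≈ (u + v + 1#) * Upoly R (deletion (feasible D) i) u v))
proposition3p1 R =
  (λ D u v → Upoly-empty R u v D) ,
  λ n D i u v → Upoly-nonLoop-nonColoop R u v D i , [ Upoly-constant R u v D i , Upoly-constant R u v D i ]′
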